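{- The inequality $c(\mathcal{G})\le\max(c(G),c(G_{\max}))$ does not hold in general: there exists a periodic graph $\mathcal{G}$ with footprint $G$ such that $c(\mathcal{G})>\max(c(G),c(G_{\max}))$.
   Context: All graphs are finite, undirected and reflexive. A periodic graph with period $p\ge1$ is a sequence $\mathcal{G}=(G_0,\dots,G_{p-1})$ of graphs $G_i=(V,E_i)$ on a common vertex set, extended by $G_{i+p}=G_i$; its footprint is $G=(V,\bigcup_iE_i)$, assumed connected. Cops and Robber on a periodic graph with $k$ cops (perfect information): cops choose starting vertices, then the robber; in each round $t=0,1,\dots$ each cop moves to a vertex of $N_{G_{t\bmod p}}[\text{its position}]$, then the robber likewise; the cops win if a cop ever moves onto the robber's vertex. The cop number $c(\cdot)$ is the least $k$ such that $k$ cops have a winning strategy; a static graph is a periodic graph of period $1$. $c(G_{\max})=\max_{0\le i\le p-1}c(G_i)$. -}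

module Defs where

open import Data.Nat using (ℕ; zero; suc; _≤_; _<_)
open import Data.Nat.DivMod using (_mod_)
open import Data.Fin using (Fin)
open import Data.Vec using (Vec; []; _∷_; head)
open import Data.Product using (Σ; ∃; _×_; _,_; proj₁; proj₂)
open import Relation.Binary.PropositionalEquality using (_≡_)

-- A periodic graph on vertex set Fin n with period p = suc q (so p ≥ 1).
-- E i is the (reflexive, symmetric) edge relation of G_i, for i < p.
-- A static graph is a periodic graph with period 1 (q = 0).
record PGraph (n q : ℕ) : Set₁ where
  field
    E    : Fin (suc q) → Fin n → Fin n → Set
    refl : ∀ i v → E i v v
    sym  : ∀ i u v → E i u v → E i v u
open PGraph public

Eat : ∀ {n q} → PGraph n q → ℕ → Fin n → Fin n → Set
Eat {q = q} 𝒢 t = E 𝒢 (t mod suc q)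

footprint : ∀ {n q} → PGraph n q → PGraph n 0
footprint 𝒢 = record
  { E    = λ _ u v → Σ _ λ i → E 𝒢 i u v
  ; refl = λ _ v → Data.Fin.zero , refl 𝒢 Data.Fin.zero v
  ; sym  = λ _ u v e → proj₁ e , sym 𝒢 (proj₁ e) u v (proj₂ e)
  }

layer : ∀ {n q} → PGraph n q → Fin (suc q) → PGraph n 0
layer 𝒢 i = record
  { E    = λ _ → E 𝒢 i
  ; refl = λ _ → refl 𝒢 i
  ; sym  = λ _ → sym 𝒢 i
  }

data Walk {n : ℕ} (R : Fin n → Fin n → Set) : Fin n → Fin n → Set where
  here : ∀ {v} → Walk R v v
  step : ∀ {u v w} → R u v → Walk R v w → Walk R u w

FootprintConnected : ∀ {n q} → PGraph n q → Set
FootprintConnected {n} 𝒢 = ∀ (u v : Fin n) → Walk (E (footprint 𝒢) Data.Fin.zero) u v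

record Config (k n : ℕ) : Set where
  constructor ⟨_,_⟩
  field
    cops  : Fin k → Fin n
    robber : Fin n
open Config public

-- a history up to round t: configurations c_t, c_{t-1}, ..., c_0 (most recent first)
Hist : ℕ → ℕ → ℕ → Set
Hist k n t = Vec (Config k n) (suc t)

record CopStrategy {n q : ℕ} (𝒢 : PGraph n q) (k : ℕ) : Set where
  field
    start : Fin k → Fin n
    move  : (t : ℕ) → Hist k n t → Fin k → Fin n
    legal : ∀ t (h : Hist k n t) (i : Fin k) →
            Eat 𝒢 t (cops (head h) i) (move t h i)
open CopStrategy public

record RobberStrategy {n q : ℕ} (𝒢 : PGraph n q) (k : ℕ) : Set where
  field
    start : (Fin k → Fin n) → Fin n
    move  : (t : ℕ) → Hist k n t → (Fin k → Fin n) → Fin n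
    legal : ∀ t (h : Hist k n t) (c : Fin k → Fin n) →
            Eat 𝒢 t (robber (head h)) (move t h c)
open RobberStrategy public

-- the play determined by the two strategies: history before round t
play : ∀ {n q k} {𝒢 : PGraph n q} → CopStrategy 𝒢 k → RobberStrategy 𝒢 k →
       (t : ℕ) → Hist k n t
play σ ρ zero = ⟨ CopStrategy.start σ , RobberStrategy.start ρ (CopStrategy.start σ) ⟩ ∷ []
play σ ρ (suc t) =
  let h  = play σ ρ t
      c' = CopStrategy.move σ t h
  in ⟨ c' , RobberStrategy.move ρ t h c' ⟩ ∷ h

CaptureAt : ∀ {n q k} {𝒢 : PGraph n q} → CopStrategy 𝒢 k → RobberStrategy 𝒢 k → ℕ → Set
CaptureAt σ ρ t =
  ∃ λ i → CopStrategy.move σ t (play σ ρ t) i ≡ robber (head (play σ ρ t))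

CopsWin : ∀ {n q} → PGraph n q → ℕ → Set
CopsWin 𝒢 k = Σ (CopStrategy 𝒢 k) λ σ → ∀ (ρ : RobberStrategy 𝒢 k) → ∃ λ t → CaptureAt σ ρ t

IsCopNumber : ∀ {n q} → PGraph n q → ℕ → Set
IsCopNumber 𝒢 c = CopsWin 𝒢 c × (∀ j → CopsWin 𝒢 j → c ≤ j)

{-# OPTIONS --safe #-}
module Submission where

-- The snapshots G₀ and G₁ are the paths 1–4–0–3–2 and 3–1–0–2–4, and their union is the
-- wheel with hub 0; all three are cop-win. A lone cop nevertheless loses the alternating
-- game: whenever the cop is on c ≠ r, the robber on r can move in the current snapshot to a
-- vertex that c cannot reach in the next one, so once out of the cop's reach he stays so.
-- Two cops on 3 and 4 dominate G₀ and catch him in the first round.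

open import Defs hiding (refl; sym)
open import Data.Bool using (Bool; T; _∧_; _∨_; false)
open import Data.Bool.Properties using (∨-comm; T?)
open import Data.Fin using (Fin; zero; suc; toℕ; #_; _≟_)
open import Data.Fin.Properties using (¬Fin0; any?; all?; toℕ-injective; toℕ-fromℕ<)
open import Data.List using (List; []; _∷_)
open import Data.Nat using (ℕ; zero; suc; NonZero; _+_; _<_; s≤s; z≤n)
open import Data.Nat.DivMod using (_mod_; _%_; %-distribˡ-+; m%n%n≡m%n)
open import Data.Nat.Properties using (≮⇒≥)
open import Data.Product using (Σ; ∃; _×_; _,_; proj₁; proj₂)
open import Data.Sum using (_⊎_; inj₁; inj₂; [_,_]′)
open import Data.Vec using (head)
open import Function using (_∘_)
open import Relation.Binary.Core using (Rel)
open import Relation.Binary.Definitions using (Decidable)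
open import Relation.Binary.PropositionalEquality
  using (_≡_; _≢_; refl; sym; cong; subst; module ≡-Reasoning)
open import Relation.Nullary using (¬_; yes; no; ¬?; contradiction)
open import Relation.Nullary.Decidable using (⌊_⌋; from-yes; _⊎-dec_; _×-dec_; _→-dec_)

private
  variable
    n q k c : ℕ

isCopNumber-intro : {𝒢 : PGraph n q} →
                    CopsWin 𝒢 c → (∀ j → j < c → ¬ CopsWin 𝒢 j) → IsCopNumber 𝒢 c
isCopNumber-intro win fewer-lose =
  win , λ j j-win → ≮⇒≥ λ j<c → fewer-lose j j<c j-win

noCops-lose : (𝒢 : PGraph (suc n) q) → ¬ CopsWin 𝒢 0
noCops-lose 𝒢 (σ , σ-wins) = ¬Fin0 (proj₁ (proj₂ (σ-wins idle)))
  where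
  idle : RobberStrategy 𝒢 0
  idle = record
    { start = λ _ → zero
    ; move  = λ _ h _ → robber (head h)
    ; legal = λ t h _ → PGraph.refl 𝒢 (t mod _) (robber (head h))
    }

copsWin1⇒isCopNumber1 : {𝒢 : PGraph (suc n) q} → CopsWin 𝒢 1 → IsCopNumber 𝒢 1
copsWin1⇒isCopNumber1 {𝒢 = 𝒢} win = isCopNumber-intro win λ
  { zero    _           → noCops-lose 𝒢
  ; (suc j) (s≤s ())
  }

nextPhase : Fin (suc q) → Fin (suc q)
nextPhase {q} i = suc (toℕ i) mod suc q

suc-mod : ∀ t n .{{_ : NonZero n}} → suc t mod n ≡ suc (toℕ (t mod n)) mod n
suc-mod t n = toℕ-injective (begin
  toℕ (suc t mod n)                ≡⟨ toℕ-fromℕ< _ ⟩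
  suc t % n                        ≡⟨ %-distribˡ-+ 1 t n ⟩
  (1 % n + t % n) % n              ≡⟨ cong (λ x → (1 % n + x) % n) (sym (m%n%n≡m%n t n)) ⟩
  (1 % n + t % n % n) % n          ≡⟨ sym (%-distribˡ-+ 1 (t % n) n) ⟩
  suc (t % n) % n                  ≡⟨ cong (λ x → suc x % n) (sym (toℕ-fromℕ< _)) ⟩
  suc (toℕ (t mod n)) % n          ≡⟨ sym (toℕ-fromℕ< _) ⟩
  toℕ (suc (toℕ (t mod n)) mod n)  ∎)
  where open ≡-Reasoning

Eat-suc : (𝒢 : PGraph n q) (t : ℕ) → Eat 𝒢 (suc t) ≡ E 𝒢 (nextPhase (t mod suc q))
Eat-suc {q = q} 𝒢 t = cong (E 𝒢) (suc-mod t (suc q))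

module _ {ℓ} {R : Rel (Fin n) ℓ} (R? : Decidable R) where

  pursue : (c r d : Fin n) → Fin n
  pursue c r d with R? c r | R? c d
  ... | yes _ | _     = r
  ... | no _  | yes _ = d
  ... | no _  | no _  = c

  pursue-legal : (∀ v → R v v) → ∀ c r d → R c (pursue c r d)
  pursue-legal R-refl c r d with R? c r | R? c d
  ... | yes cr | _     = cr
  ... | no _   | yes cd = cd
  ... | no _   | no _   = R-refl c

  pursue-catches : ∀ {c r} d → R c r → pursue c r d ≡ r
  pursue-catches {c} {r} d cr with R? c r
  ... | yes _  = refl
  ... | no ¬cr = contradiction cr ¬cr

  pursue-advances : ∀ {c r d} → ¬ R c r → R c d → pursue c r d ≡ d
  pursue-advances {c} {r} {d} ¬cr cd with R? c r | R? c d
  ... | yes cr | _      = contradiction cr ¬cr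
  ... | no _   | yes _  = refl
  ... | no _   | no ¬cd = contradiction cd ¬cd

dominatingStart⇒copsWin : (𝒢 : PGraph n q) → (∀ i → Decidable (E 𝒢 i)) →
                          (s : Fin k → Fin n) → (∀ r → ∃ λ j → E 𝒢 zero (s j) r) →
                          CopsWin 𝒢 k
dominatingStart⇒copsWin {q = q} 𝒢 E? s dominates = σ , λ ρ →
  let j , sj-r = dominates (RobberStrategy.start ρ s)
  in 0 , j , pursue-catches (E? zero) (s j) sj-r
  where
  σ : CopStrategy 𝒢 _
  σ = record
    { start = s
    ; move  = λ t h j → pursue (E? (t mod suc q)) (cops (head h) j) (robber (head h))
                                 (cops (head h) j)
    ; legal = λ t h j → pursue-legal (E? (t mod suc q)) (PGraph.refl 𝒢 (t mod suc q)) _ _ _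
    }

twoRoundCatch⇒copsWin : (𝒢 : PGraph n q) → (∀ i → Decidable (E 𝒢 i)) → (c₀ : Fin n) →
                       (∀ r → Eat 𝒢 0 c₀ r ⊎
                              ∃ λ d → Eat 𝒢 0 c₀ d × (∀ r′ → Eat 𝒢 0 r r′ → Eat 𝒢 1 d r′)) →
                       CopsWin 𝒢 1
twoRoundCatch⇒copsWin {q = q} 𝒢 E? c₀ cover = σ , σ-wins
  where
  target : Fin _ → Fin _
  target r = [ (λ _ → r) , proj₁ ]′ (cover r)

  target-covers : ∀ {r} → ¬ Eat 𝒢 0 c₀ r →
                  Eat 𝒢 0 c₀ (target r) × (∀ r′ → Eat 𝒢 0 r r′ → Eat 𝒢 1 (target r) r′)
  target-covers {r} ¬c₀r with cover r
  ... | inj₁ c₀r      = contradiction c₀r ¬c₀r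
  ... | inj₂ (_ , dr) = dr

  σ : CopStrategy 𝒢 1
  σ = record
    { start = λ _ → c₀
    ; move  = λ t h j → pursue (E? (t mod suc q)) (cops (head h) j) (robber (head h))
                                 (target (robber (head h)))
    ; legal = λ t h j → pursue-legal (E? (t mod suc q)) (PGraph.refl 𝒢 (t mod suc q)) _ _ _
    }

  σ-wins : ∀ ρ → ∃ λ t → CaptureAt σ ρ t
  σ-wins ρ with E? zero c₀ (robber (head (play σ ρ 0)))
  ... | yes c₀r = 0 , zero , pursue-catches (E? zero) _ c₀r
  ... | no ¬c₀r = 1 , zero , pursue-catches (E? (1 mod suc q)) _ c₁r₁
    where
    c₁r₁ : Eat 𝒢 1 (cops (head (play σ ρ 1)) zero) (robber (head (play σ ρ 1)))
    c₁r₁ = subst (λ c₁ → Eat 𝒢 1 c₁ (robber (head (play σ ρ 1))))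
                 (sym (pursue-advances (E? zero) ¬c₀r (proj₁ (target-covers ¬c₀r))))
                 (proj₂ (target-covers ¬c₀r) _ (RobberStrategy.legal ρ 0 (play σ ρ 0) _))

escapes⇒¬copsWin1 : (𝒢 : PGraph n q) →
                  (∀ c → ∃ λ r → ¬ E 𝒢 zero c r) →
                  (∀ i c r → c ≢ r → ∃ λ r′ → E 𝒢 i r r′ × ¬ E 𝒢 (nextPhase i) c r′) →
                  ¬ CopsWin 𝒢 1
escapes⇒¬copsWin1 {q = q} 𝒢 hide escape (σ , σ-wins) = never-caught (σ-wins ρ)
  where
  flee : ℕ → (c r : Fin _) → Fin _
  flee t c r with c ≟ r
  ... | yes _   = r
  ... | no c≢r = proj₁ (escape (t mod suc q) c r c≢r)

  flee-legal : ∀ t c r → Eat 𝒢 t r (flee t c r)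
  flee-legal t c r with c ≟ r
  ... | yes _   = PGraph.refl 𝒢 (t mod suc q) r
  ... | no c≢r = proj₁ (proj₂ (escape (t mod suc q) c r c≢r))

  flee-safe : ∀ t {c r} → c ≢ r → ¬ Eat 𝒢 (suc t) c (flee t c r)
  flee-safe t {c} {r} c≢r with c ≟ r
  ... | yes c≡r  = contradiction c≡r c≢r
  ... | no c≢r′ = subst (λ F → ¬ F c _) (sym (Eat-suc 𝒢 t))
                        (proj₂ (proj₂ (escape (t mod suc q) c r c≢r′)))

  ρ : RobberStrategy 𝒢 1
  ρ = record
    { start = λ cs → proj₁ (hide (cs zero))
    ; move  = λ t h cs → flee t (cs zero) (robber (head h))
    ; legal = λ t h cs → flee-legal t (cs zero) (robber (head h))
    }

  out-of-reach : ∀ t → ¬ Eat 𝒢 t (cops (head (play σ ρ t)) zero) (robber (head (play σ ρ t)))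
  missed : ∀ t → CopStrategy.move σ t (play σ ρ t) zero ≢ robber (head (play σ ρ t))

  out-of-reach zero    = proj₂ (hide _)
  out-of-reach (suc t) = flee-safe t (missed t)

  missed t caught =
    out-of-reach t (subst (Eat 𝒢 t _) caught (CopStrategy.legal σ t (play σ ρ t) zero))

  never-caught : ¬ ∃ (CaptureAt σ ρ)
  never-caught (t , zero , caught) = missed t caught

footprint-dec : (𝒢 : PGraph n q) → (∀ i → Decidable (E 𝒢 i)) →
                ∀ i → Decidable (E (footprint 𝒢) i)
footprint-dec 𝒢 E? _ u v = any? λ i → E? i u v

hub⇒footprintConnected : (𝒢 : PGraph n q) (h : Fin n) →
                         (∀ v → E (footprint 𝒢) zero h v) → FootprintConnected 𝒢
hub⇒footprintConnected 𝒢 h hub u v =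
  step (PGraph.sym (footprint 𝒢) zero h u (hub u)) (step (hub v) here)

V : Set
V = Fin 5

consecutive : List V → V → V → Bool
consecutive (a ∷ b ∷ vs) u v = (⌊ a ≟ u ⌋ ∧ ⌊ b ≟ v ⌋) ∨ consecutive (b ∷ vs) u v
consecutive _            _ _ = false

path : Fin 2 → List V
path zero    = # 1 ∷ # 4 ∷ # 0 ∷ # 3 ∷ # 2 ∷ []
path (suc _) = # 3 ∷ # 1 ∷ # 0 ∷ # 2 ∷ # 4 ∷ []

Adj : Fin 2 → V → V → Set
Adj i u v = u ≡ v ⊎ T (consecutive (path i) u v ∨ consecutive (path i) v u)

adj? : ∀ i → Decidable (Adj i)
adj? i u v = u ≟ v ⊎-dec T? _

Adj-sym : ∀ i u v → Adj i u v → Adj i v u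
Adj-sym i u v = [ inj₁ ∘ sym , inj₂ ∘ subst T (∨-comm (consecutive (path i) u v) _) ]′

alternatingPaths : PGraph 5 1
alternatingPaths = record { E = Adj ; refl = λ _ _ → inj₁ refl ; sym = Adj-sym }

alternatingPaths-hub : ∀ v → E (footprint alternatingPaths) zero (# 0) v
alternatingPaths-hub = from-yes (all? λ v → footprint-dec alternatingPaths adj? zero (# 0) v)

alternatingPaths-oneCopLoses : ¬ CopsWin alternatingPaths 1
alternatingPaths-oneCopLoses = escapes⇒¬copsWin1 alternatingPaths
  (from-yes (all? λ c → any? λ r → ¬? (adj? zero c r)))
  (from-yes (all? λ i → all? λ c → all? λ r →
    ¬? (c ≟ r) →-dec any? λ r′ → adj? i r r′ ×-dec ¬? (adj? (nextPhase i) c r′)))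

alternatingPaths-twoCopsWin : CopsWin alternatingPaths 2
alternatingPaths-twoCopsWin = dominatingStart⇒copsWin alternatingPaths adj? guards
  (from-yes (all? λ r → any? λ j → adj? zero (guards j) r))
  where
  guards : Fin 2 → V
  guards zero    = # 3
  guards (suc _) = # 4

alternatingPaths-copNumber : IsCopNumber alternatingPaths 2
alternatingPaths-copNumber = isCopNumber-intro alternatingPaths-twoCopsWin λ where
  zero          _              → noCops-lose alternatingPaths
  (suc zero)    _              → alternatingPaths-oneCopLoses
  (suc (suc _)) (s≤s (s≤s ()))

snapshot-copsWin : ∀ i → CopsWin (layer alternatingPaths i) 1
snapshot-copsWin i =
  twoRoundCatch⇒copsWin (layer alternatingPaths i) (λ _ → adj? i) (# 0) (cover i)
  where
  cover : ∀ i r → Adj i (# 0) r ⊎ ∃ λ d → Adj i (# 0) d × (∀ r′ → Adj i r r′ → Adj i d r′)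
  cover = from-yes (all? λ i → all? λ r → adj? i (# 0) r ⊎-dec
            any? λ d → adj? i (# 0) d ×-dec all? λ r′ → adj? i r r′ →-dec adj? i d r′)

footprint-copsWin : CopsWin (footprint alternatingPaths) 1
footprint-copsWin = dominatingStart⇒copsWin (footprint alternatingPaths)
  (footprint-dec alternatingPaths adj?) (λ _ → # 0) (λ r → zero , alternatingPaths-hub r)

theorem4 : Σ ℕ λ n → Σ ℕ λ q → Σ (PGraph n q) λ 𝒢 →
           FootprintConnected 𝒢 ×
           Σ ℕ λ c𝒢 → Σ ℕ λ cG → Σ (Fin (suc q) → ℕ) λ cGi →
             IsCopNumber 𝒢 c𝒢 × IsCopNumber (footprint 𝒢) cG ×
             (∀ i → IsCopNumber (layer 𝒢 i) (cGi i)) ×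
             cG < c𝒢 × (∀ i → cGi i < c𝒢)
theorem4 =
  5 , 1 , alternatingPaths ,
  hub⇒footprintConnected alternatingPaths (# 0) alternatingPaths-hub ,
  2 , 1 , (λ _ → 1) ,
  alternatingPaths-copNumber ,
  copsWin1⇒isCopNumber1 footprint-copsWin ,
  (λ i → copsWin1⇒isCopNumber1 (snapshot-copsWin i)) ,
  s≤s (s≤s z≤n) , (λ _ → s≤s (s≤s z≤n))
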